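{- Let $S=\{R_0,\dots,R_d\}$ be an association scheme and $T$ a singular subset of $S$. Then: (i) $O^\vartheta(S)\subseteq T$; (ii) $O^\vartheta(S)O_\vartheta(S)$ is a closed subset of $S$ and is a singular subset of $S$; (iii) $O^\vartheta(S)O_\vartheta(S)\subseteq T$.
   Context: $S$ is an association scheme on a finite set with relations $R_0$ (diagonal), $R_1,\dots,R_d$, transposes $R_{i^*}$, intersection numbers $p_{ij}^k$, valencies $k_i=p_{ii^*}^0$. For nonempty $U,V\subseteq S$, $UV=\{R_k:\exists R_u\in U,R_v\in V,\ p_{uv}^k>0\}$ ($R_i$ stands for $\{R_i\}$). $T\subseteq S$ nonempty is closed if $T^*T\subseteq T$, $T^*=\{R_{i^*}:R_i\in T\}$; strongly normal if also $R_{i^*}TR_i\subseteq T$ for all $i$. $O_\vartheta(S)=\{R_i:k_i=1\}$; $O^\vartheta(S)$ is the intersection of all strongly normal closed subsets. A subset $T\subseteq S$ is singular if (i) $O_\vartheta(S)\subseteq T$ and (ii) $R_xR_{y^*}R_yR_z\subseteq T$ for all $R_x\in O_\vartheta(S)$, $R_y\in S$, $R_z\in T$. -}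

module Defs where

open import Data.Nat using (ℕ; zero; suc; _+_; _<_)
open import Data.Bool using (Bool; true; false; _∧_)
open import Data.Fin using (Fin; zero; suc; _≟_)
open import Data.Fin.Subset using (Subset; _∈_)
open import Data.Product using (Σ; ∃; _×_; _,_)
open import Relation.Binary.PropositionalEquality using (_≡_)
open import Relation.Nullary.Decidable using (⌊_⌋)
open import Relation.Unary using (Pred; _⊆_)
open import Level using (0ℓ)

countF : ∀ {n} → (Fin n → Bool) → ℕ
countF {zero}  f = 0
countF {suc n} f with f zero
... | true  = suc (countF (λ z → f (suc z)))
... | false = countF (λ z → f (suc z))

-- An association scheme on the finite set Fin n with relations R_0,…,R_d.
-- (x , y) ∈ R_i  iff  rel x y ≡ i.  Index 0 (Fin.zero) is the diagonal relation.
record Scheme (n d : ℕ) : Set where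
  field
    rel      : Fin n → Fin n → Fin (suc d)
    diag→    : ∀ x y → rel x y ≡ zero → x ≡ y
    →diag    : ∀ x → rel x x ≡ zero
    nonempty : ∀ i → ∃ λ x → ∃ λ y → rel x y ≡ i
    tr       : Fin (suc d) → Fin (suc d)
    tr-spec  : ∀ x y → rel y x ≡ tr (rel x y)
    p        : Fin (suc d) → Fin (suc d) → Fin (suc d) → ℕ
    p-spec   : ∀ i j x y →
               countF (λ z → ⌊ rel x z ≟ i ⌋ ∧ ⌊ rel z y ≟ j ⌋) ≡ p i j (rel x y)

module _ {n d : ℕ} (S : Scheme n d) where
  open Scheme S

  Idx : Set
  Idx = Fin (suc d)

  val : Idx → ℕ
  val i = p i (tr i) zero

  ｛_｝ : Idx → Pred Idx 0ℓ
  ｛ i ｝ = λ k → k ≡ i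

  _·_ : Pred Idx 0ℓ → Pred Idx 0ℓ → Pred Idx 0ℓ
  (U · V) k = Σ Idx λ u → Σ Idx λ v → U u × V v × 0 < p u v k
  infixl 7 _·_

  _* : Pred Idx 0ℓ → Pred Idx 0ℓ
  (T *) i = T (tr i)

  Closed : Pred Idx 0ℓ → Set
  Closed T = (∃ λ i → T i) × ((T *) · T ⊆ T)

  StronglyNormalClosed : Pred Idx 0ℓ → Set
  StronglyNormalClosed T = Closed T × (∀ i → ｛ tr i ｝ · T · ｛ i ｝ ⊆ T)

  OLow : Pred Idx 0ℓ
  OLow i = val i ≡ 1

  OUp : Pred Idx 0ℓ
  OUp i = ∀ (T : Subset (suc d)) → StronglyNormalClosed (_∈ T) → i ∈ T

  Singular : Pred Idx 0ℓ → Set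
  Singular T = (OLow ⊆ T) ×
    (∀ x y z → OLow x → T z → ｛ x ｝ · ｛ tr y ｝ · ｛ y ｝ · ｛ z ｝ ⊆ T)

-- Thin relations (valency 1) are graphs of permutations of the points: every point has exactly one
-- successor and, since the successor map is then a surjective endomap of a finite set, exactly one
-- predecessor. Hence thin labels are closed under reversal and under quotients.
--
-- For (i), call b and e siblings when rel c b ≡ rel c e for some c. The labels all of whose pairs
-- are joined by sibling chains form a strongly normal closed subset, and singularity of T with x = 0
-- moves membership of rel e f in T back to rel b f along such a chain. That subset is not decidable
-- constructively, so O^θ(S) lands only in its double negation; membership in T is decidable, which
-- suffices.
--
-- For (ii) and (iii), a label of O^θ(S)O_θ(S) is a path a → h → b with an O^θ(S)-label followed by
-- a thin one; the paths required are obtained by rerouting, using strong normality of O^θ(S) and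
-- closure of thin labels under quotients.

module Submission where

open import Defs
open import Data.Bool using (Bool; true; false; T; _∧_)
open import Data.Bool.Properties using (T-∧)
open import Data.Empty using (⊥-elim)
open import Data.Fin using (Fin; zero; suc; _≟_; punchOut)
open import Data.Fin.Properties using (0≢1+n; suc-injective; punchOut-injective; injective⇒≤)
open import Data.Fin.Subset using (Subset; _∈_)
open import Data.Fin.Subset.Properties using (_∈?_)
open import Data.Nat using (ℕ; zero; suc; _<_; z<s)
open import Data.Nat.Properties using (<-irrefl)
import Data.Nat.Properties as ℕₚ
open import Data.Product using (∃; _×_; _,_; proj₁; proj₂; map; map₂)
open import Data.Unit using (tt)
open import Data.Vec using (tabulate)
open import Data.Vec.Properties using (lookup∘tabulate; lookup⇒[]=; []=⇒lookup)
open import Function using (_∘_; id)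
open import Function.Bundles using (Equivalence)
open import Function.Definitions using (Injective)
open import Level using (0ℓ)
open import Relation.Binary.Core using (Rel)
open import Relation.Binary.Definitions using (Symmetric)
open import Relation.Binary.PropositionalEquality
  using (_≡_; _≢_; refl; sym; trans; cong; subst; module ≡-Reasoning)
open import Relation.Binary.Construct.Closure.Transitive
  using (TransClosure; [_]; _∷_; _++_; symmetric)
open import Relation.Nullary using (¬_; yes; no; does; contradiction)
open import Relation.Nullary.Decidable
  using (⌊_⌋; dec-true; toWitness; fromWitness; decidable-stable; ¬¬-excluded-middle)
open import Relation.Nullary.Negation using (¬¬-map)
open import Relation.Unary using (Pred; Decidable; _⊆_)

countF-pos : ∀ {n} (f : Fin n → Bool) {z} → T (f z) → 0 < countF f
countF-pos {suc n} f {z} t with f zero in f0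
... | true = z<s
countF-pos f {zero}  t | false = ⊥-elim (subst T f0 t)
countF-pos f {suc z} t | false = countF-pos (f ∘ suc) t

countF-witness : ∀ {n} (f : Fin n → Bool) → 0 < countF f → ∃ (T ∘ f)
countF-witness {suc n} f pos with f zero in f0
... | true = zero , subst T (sym f0) tt
... | false with countF-witness (f ∘ suc) pos
...   | z , t = suc z , t

countF≡0⇒¬T : ∀ {n} (f : Fin n → Bool) → countF f ≡ 0 → ∀ {z} → ¬ T (f z)
countF≡0⇒¬T f count≡0 t = <-irrefl refl (subst (0 <_) count≡0 (countF-pos f t))

¬T⇒countF≡0 : ∀ {n} (f : Fin n → Bool) → (∀ z → ¬ T (f z)) → countF f ≡ 0
¬T⇒countF≡0 {zero}  f none = refl
¬T⇒countF≡0 {suc n} f none with f zero in f0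
... | true  = contradiction (subst T (sym f0) tt) (none zero)
... | false = ¬T⇒countF≡0 (f ∘ suc) (none ∘ suc)

unique⇒countF≡1 : ∀ {n} (f : Fin n → Bool) {z} →
                  T (f z) → (∀ {z′} → T (f z′) → z′ ≡ z) → countF f ≡ 1
unique⇒countF≡1 {suc n} f {z} t unique with f zero in f0
... | true  = cong suc (¬T⇒countF≡0 (f ∘ suc) λ z′ t′ →
                0≢1+n (trans (unique (subst T (sym f0) tt)) (sym (unique t′))))
unique⇒countF≡1 f {zero}  t unique | false = ⊥-elim (subst T f0 t)
unique⇒countF≡1 f {suc z} t unique | false =
  unique⇒countF≡1 (f ∘ suc) t (λ t′ → suc-injective (unique t′))

countF≡1⇒unique : ∀ {n} (f : Fin n → Bool) → countF f ≡ 1 →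
                  ∀ {z z′} → T (f z) → T (f z′) → z ≡ z′
countF≡1⇒unique {suc n} f count≡1 {z} {z′} t t′ with f zero in f0
countF≡1⇒unique f count≡1 {zero}  {zero}   t t′ | true = refl
countF≡1⇒unique f count≡1 {zero}  {suc z′} t t′ | true =
  contradiction t′ (countF≡0⇒¬T (f ∘ suc) (ℕₚ.suc-injective count≡1))
countF≡1⇒unique f count≡1 {suc z} t t′ | true =
  contradiction t (countF≡0⇒¬T (f ∘ suc) (ℕₚ.suc-injective count≡1))
countF≡1⇒unique f count≡1 {zero}           t t′ | false = ⊥-elim (subst T f0 t)
countF≡1⇒unique f count≡1 {suc z} {zero}   t t′ | false = ⊥-elim (subst T f0 t′)
countF≡1⇒unique f count≡1 {suc z} {suc z′} t t′ | false =
  cong suc (countF≡1⇒unique (f ∘ suc) count≡1 t t′)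

∈-tabulate⁺ : ∀ {n} {P : Pred (Fin n) 0ℓ} (P? : Decidable P) {i} → P i → i ∈ tabulate (does ∘ P?)
∈-tabulate⁺ P? {i} Pi = lookup⇒[]= i _ (trans (lookup∘tabulate (does ∘ P?) i) (dec-true (P? i) Pi))

∈-tabulate⁻ : ∀ {n} {P : Pred (Fin n) 0ℓ} (P? : Decidable P) {i} → i ∈ tabulate (does ∘ P?) → P i
∈-tabulate⁻ P? {i} i∈ with P? i | trans (sym (lookup∘tabulate (does ∘ P?) i)) ([]=⇒lookup i∈)
... | yes Pi | _  = Pi
... | no _   | ()

¬¬-decidable : ∀ {n} (P : Pred (Fin n) 0ℓ) → ¬ ¬ Decidable P
¬¬-decidable {zero}  P ¬dec = ¬dec λ ()
¬¬-decidable {suc n} P ¬dec = ¬¬-excluded-middle λ P0? → ¬¬-decidable (P ∘ suc) λ Psuc? →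
  ¬dec λ { zero → P0? ; (suc i) → Psuc? i }

injective-endo-hits : ∀ {n} {g : Fin (suc n) → Fin (suc n)} → Injective _≡_ _≡_ g →
                      ∀ w → ¬ (∀ q → g q ≢ w)
injective-endo-hits {g = g} g-inj w misses = <-irrefl refl (injective⇒≤ punched-injective)
  where
  punched : Fin _ → Fin _
  punched q = punchOut (misses q ∘ sym)
  punched-injective : Injective _≡_ _≡_ punched
  punched-injective {q} {q′} eq = g-inj (punchOut-injective (misses q ∘ sym) (misses q′ ∘ sym) eq)

-- The section g is injective, so it hits z₁ and z₂; yet each of their g-preimages is f z₁.
surjective⇒injective : ∀ {n} (f : Fin n → Fin n) → (∀ q → ∃ λ z → f z ≡ q) →
                       Injective _≡_ _≡_ f
surjective⇒injective {zero} f surj {()}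
surjective⇒injective {suc n} f surj {z₁} {z₂} fz₁≡fz₂ =
  decidable-stable (z₁ ≟ z₂) λ z₁≢z₂ →
  injective-endo-hits g-inj z₁ λ q gq≡z₁ → injective-endo-hits g-inj z₂ λ q′ gq′≡z₂ →
  z₁≢z₂ (trans (sym gq≡z₁) (trans (cong g (section-fibre gq≡z₁ gq′≡z₂)) gq′≡z₂))
  where
  g : Fin (suc n) → Fin (suc n)
  g q = proj₁ (surj q)
  f∘g : ∀ q → f (g q) ≡ q
  f∘g q = proj₂ (surj q)
  open ≡-Reasoning
  g-inj : Injective _≡_ _≡_ g
  g-inj {q} {q′} eq = trans (sym (f∘g q)) (trans (cong f eq) (f∘g q′))
  section-fibre : ∀ {q q′} → g q ≡ z₁ → g q′ ≡ z₂ → q ≡ q′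
  section-fibre {q} {q′} gq≡z₁ gq′≡z₂ = begin
    q          ≡⟨ f∘g q ⟨
    f (g q)    ≡⟨ cong f gq≡z₁ ⟩
    f z₁       ≡⟨ fz₁≡fz₂ ⟩
    f z₂       ≡⟨ cong f gq′≡z₂ ⟨
    f (g q′)   ≡⟨ f∘g q′ ⟩
    q′         ∎

module _ {n d : ℕ} (S : Scheme n d) where
  open Scheme S

  on-path : Idx S → Idx S → Fin n → Fin n → Fin n → Bool
  on-path i j x y z = ⌊ rel x z ≟ i ⌋ ∧ ⌊ rel z y ≟ j ⌋

  on-path⁺ : ∀ {i j x y z} → rel x z ≡ i → rel z y ≡ j → T (on-path i j x y z)
  on-path⁺ {i} {j} {x} {y} {z} xz≡i zy≡j =
    Equivalence.from T-∧ (fromWitness {a? = rel x z ≟ i} xz≡i , fromWitness {a? = rel z y ≟ j} zy≡j)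

  on-path⁻ : ∀ {i j x y z} → T (on-path i j x y z) → rel x z ≡ i × rel z y ≡ j
  on-path⁻ {i} {j} {x} {y} {z} t =
    map (toWitness {a? = rel x z ≟ i}) (toWitness {a? = rel z y ≟ j}) (Equivalence.to T-∧ t)

  path⇒p>0 : ∀ {i j x y} z → rel x z ≡ i → rel z y ≡ j → 0 < p i j (rel x y)
  path⇒p>0 {i} {j} {x} {y} z xz≡i zy≡j =
    subst (0 <_) (p-spec i j x y) (countF-pos (on-path i j x y) (on-path⁺ xz≡i zy≡j))

  p>0⇒path : ∀ {i j k x y} → 0 < p i j k → rel x y ≡ k → ∃ λ z → rel x z ≡ i × rel z y ≡ j
  p>0⇒path {i} {j} {x = x} {y} p>0 refl =
    map₂ on-path⁻ (countF-witness (on-path i j x y) (subst (0 <_) (sym (p-spec i j x y)) p>0))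

  rel-swap : ∀ {x y i} → rel x y ≡ i → rel y x ≡ tr i
  rel-swap {x} {y} refl = tr-spec x y

  tr-involutive : ∀ i → tr (tr i) ≡ i
  tr-involutive i with nonempty i
  ... | x , y , refl = sym (rel-swap (rel-swap refl))

  rel-refl : ∀ a b → rel a a ≡ rel b b
  rel-refl a b = trans (→diag a) (sym (→diag b))

  successor : ∀ i a → ∃ λ z → rel a z ≡ i
  successor i a with nonempty i
  ... | u , v , uv≡i = map₂ proj₁ (p>0⇒path (path⇒p>0 v uv≡i (rel-swap uv≡i)) (rel-refl a u))

  predecessor : ∀ i a → ∃ λ z → rel z a ≡ i
  predecessor i a = map₂ (λ az≡tri → trans (rel-swap az≡tri) (tr-involutive i)) (successor (tr i) a)

  triangle-transfer : ∀ {x y x′ y′} → rel x y ≡ rel x′ y′ →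
                      ∀ z → ∃ λ z′ → rel x′ z′ ≡ rel x z × rel z′ y′ ≡ rel z y
  triangle-transfer xy≡x′y′ z = p>0⇒path (path⇒p>0 z refl refl) (sym xy≡x′y′)

  ·-intro : ∀ {U V : Pred (Idx S) 0ℓ} {a b} m → U (rel a m) → V (rel m b) → _·_ S U V (rel a b)
  ·-intro {a = a} {b} m Uam Vmb = rel a m , rel m b , Uam , Vmb , path⇒p>0 m refl refl

  ·-elim : ∀ {U V : Pred (Idx S) 0ℓ} {k a b} → _·_ S U V k → rel a b ≡ k →
           ∃ λ m → U (rel a m) × V (rel m b)
  ·-elim (_ , _ , Uu , Vv , p>0) ab≡k with p>0⇒path p>0 ab≡k
  ... | m , refl , refl = m , Uu , Vv

  ·-⊆ : ∀ {U V W : Pred (Idx S) 0ℓ} →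
        (∀ {a m b} → U (rel a m) → V (rel m b) → W (rel a b)) → _·_ S U V ⊆ W
  ·-⊆ pointwise {k} UVk with nonempty k
  ... | a , b , refl with ·-elim UVk refl
  ...   | m , Uam , Vmb = pointwise Uam Vmb

  ·-mono : ∀ {U U′ V V′ : Pred (Idx S) 0ℓ} →
           U ⊆ U′ → V ⊆ V′ → _·_ S U V ⊆ _·_ S U′ V′
  ·-mono U⊆U′ V⊆V′ (u , v , Uu , Vv , p>0) = u , v , U⊆U′ Uu , V⊆V′ Vv , p>0

  ⊆-·ˡ : ∀ {U V : Pred (Idx S) 0ℓ} → U zero → V ⊆ _·_ S U V
  ⊆-·ˡ {U} U0 {k} Vk with nonempty k
  ... | a , b , refl = ·-intro a (subst U (sym (→diag a)) U0) Vk

  count-successors : ∀ i a → countF (on-path i (tr i) a a) ≡ val S i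
  count-successors i a = trans (p-spec i (tr i) a a) (cong (p i (tr i)) (→diag a))

  thin-successor-unique : ∀ {x a z z′} → OLow S x → rel a z ≡ x → rel a z′ ≡ x → z ≡ z′
  thin-successor-unique {x} {a} thin az≡x az′≡x =
    countF≡1⇒unique (on-path x (tr x) a a) (trans (count-successors x a) thin)
      (on-path⁺ az≡x (rel-swap az≡x)) (on-path⁺ az′≡x (rel-swap az′≡x))

  unique-successor⇒thin : ∀ {x a e} → rel a e ≡ x → (∀ {z} → rel a z ≡ x → z ≡ e) → OLow S x
  unique-successor⇒thin {x} {a} ae≡x unique =
    trans (sym (count-successors x a))
      (unique⇒countF≡1 (on-path x (tr x) a a) (on-path⁺ ae≡x (rel-swap ae≡x))
        (unique ∘ proj₁ ∘ on-path⁻))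

  thin-predecessor-unique : ∀ {x a z z′} → OLow S x → rel z a ≡ x → rel z′ a ≡ x → z ≡ z′
  thin-predecessor-unique {x} thin za≡x z′a≡x =
    surjective⇒injective next next-surjective (trans (next-unique za≡x) (sym (next-unique z′a≡x)))
    where
    next : Fin n → Fin n
    next w = proj₁ (successor x w)
    next-unique : ∀ {w q} → rel w q ≡ x → next w ≡ q
    next-unique {w} wq≡x = thin-successor-unique thin (proj₂ (successor x w)) wq≡x
    next-surjective : ∀ q → ∃ λ w → next w ≡ q
    next-surjective q = map₂ next-unique (predecessor x q)

  thin-zero : OLow S zero
  thin-zero with nonempty zero
  ... | a , _ = unique-successor⇒thin (→diag a) (λ {z} az≡0 → sym (diag→ a z az≡0))

  thin-refl : ∀ a → OLow S (rel a a)
  thin-refl a = subst (OLow S) (sym (→diag a)) thin-zero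

  thin-tr : ∀ {x} → OLow S x → OLow S (tr x)
  thin-tr {x} thin with nonempty x
  ... | a , _ with predecessor x a
  ...   | z , za≡x = unique-successor⇒thin (rel-swap za≡x) λ az≡trx →
    thin-predecessor-unique thin (trans (rel-swap az≡trx) (tr-involutive x)) za≡x

  thin-quotient : ∀ {y q e} → OLow S (rel y q) → OLow S (rel y e) → OLow S (rel q e)
  thin-quotient {y} {q} {e} thin-yq thin-ye = unique-successor⇒thin refl unique
    where
    -- Transporting y from the pair (q, e) to (q, z) gives y back, since rel y q is thin.
    unique : ∀ {z} → rel q z ≡ rel q e → z ≡ e
    unique {z} qz≡qe with triangle-transfer (sym qz≡qe) y
    ... | y′ , qy′≡qy , y′z≡ye
      with thin-predecessor-unique thin-yq (trans (rel-swap qy′≡qy) (sym (tr-spec q y))) refl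
    ...   | refl = thin-successor-unique thin-ye y′z≡ye refl

  closed-intro : ∀ {P : Pred (Idx S) 0ℓ} → ∃ P →
                 (∀ {a m b} → P (rel m a) → P (rel m b) → P (rel a b)) → Closed S P
  closed-intro {P} nonempty-P pointwise =
    nonempty-P , ·-⊆ (λ {a} {m} P*am Pmb → pointwise (subst P (sym (tr-spec a m)) P*am) Pmb)

  closed-elim : ∀ {P : Pred (Idx S) 0ℓ} → Closed S P →
                ∀ {a m b} → P (rel m a) → P (rel m b) → P (rel a b)
  closed-elim {P} (_ , closed) {a} {m} Pma Pmb = closed (·-intro m (subst P (tr-spec a m) Pma) Pmb)

  closed-zero : ∀ {P : Pred (Idx S) 0ℓ} → Closed S P → P zero
  closed-zero {P} closed@((i , Pi) , _) with nonempty i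
  ... | x , y , refl = subst P (→diag y) (closed-elim closed Pi Pi)

  closed-refl : ∀ {P : Pred (Idx S) 0ℓ} → Closed S P → ∀ a → P (rel a a)
  closed-refl {P} closed a = subst P (sym (→diag a)) (closed-zero closed)

  snc-conj : ∀ {P : Pred (Idx S) 0ℓ} → StronglyNormalClosed S P →
             ∀ {m w c e} → P (rel m w) → rel m c ≡ rel w e → P (rel c e)
  snc-conj (_ , normal) {m} {w} {c} {e} Pmw mc≡we =
    normal (rel m c) (·-intro w (·-intro m (tr-spec m c) Pmw) (sym mc≡we))

  snc-sibling : ∀ {P : Pred (Idx S) 0ℓ} → StronglyNormalClosed S P →
                ∀ {c b e} → rel c b ≡ rel c e → P (rel b e)
  snc-sibling snc {c} = snc-conj snc (closed-refl (proj₁ snc) c)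

  snc-resp : ∀ {P Q : Pred (Idx S) 0ℓ} → P ⊆ Q → Q ⊆ P →
             StronglyNormalClosed S P → StronglyNormalClosed S Q
  snc-resp P⊆Q Q⊆P (((i , Pi) , closed) , normal) =
    ((i , P⊆Q Pi) , P⊆Q ∘ closed ∘ ·-mono Q⊆P Q⊆P) ,
    λ j → P⊆Q ∘ normal j ∘ ·-mono (·-mono id Q⊆P) id

  OUp-snc : StronglyNormalClosed S (OUp S)
  OUp-snc = ((zero , OUp-zero) , OUp-closed) , OUp-normal
    where
    OUp-zero : OUp S zero
    OUp-zero X snc = closed-zero (proj₁ snc)
    OUp-closed : _·_ S (_* S (OUp S)) (OUp S) ⊆ OUp S
    OUp-closed uv X snc = proj₂ (proj₁ snc) (·-mono (λ u∈ → u∈ X snc) (λ v∈ → v∈ X snc) uv)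
    OUp-normal : ∀ i → _·_ S (_·_ S (｛_｝ S (tr i)) (OUp S)) (｛_｝ S i) ⊆ OUp S
    OUp-normal i conjugate X snc = proj₂ snc i (·-mono (·-mono id (λ v∈ → v∈ X snc)) id conjugate)

  OUp⊆¬¬ : ∀ {P : Pred (Idx S) 0ℓ} → StronglyNormalClosed S P → OUp S ⊆ (λ i → ¬ ¬ P i)
  OUp⊆¬¬ {P} snc i∈OUp ¬Pi = ¬¬-decidable P λ P? →
    ¬Pi (∈-tabulate⁻ P? (i∈OUp (tabulate (does ∘ P?))
                               (snc-resp (∈-tabulate⁺ P?) (∈-tabulate⁻ P?) snc)))

  Sibling : Rel (Fin n) 0ℓ
  Sibling b e = ∃ λ c → rel c b ≡ rel c e

  SiblingChain : Rel (Fin n) 0ℓ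
  SiblingChain = TransClosure Sibling

  SiblingConnected : Pred (Idx S) 0ℓ
  SiblingConnected k = ∀ {b e} → rel b e ≡ k → SiblingChain b e

  sibling-sym : Symmetric Sibling
  sibling-sym = map₂ sym

  sibling-translate : ∀ {m w c e} → Sibling m w → rel m c ≡ rel w e → SiblingChain c e
  sibling-translate {m} {w} {c} (x , xm≡xw) mc≡we with triangle-transfer xm≡xw c
  ... | z , xz≡xc , zw≡cm =
    (x , sym xz≡xc) ∷ [ w , trans (rel-swap zw≡cm) (trans (sym (tr-spec c m)) mc≡we) ]

  chain-translate : ∀ {m w c e} → SiblingChain m w → rel m c ≡ rel w e → SiblingChain c e
  chain-translate [ m~w ] mc≡we = sibling-translate m~w mc≡we
  chain-translate {m} {c = c} (_∷_ {y = h} m~h h~⁺w) mc≡we with successor (rel m c) h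
  ... | h′ , hh′≡mc =
    sibling-translate m~h (sym hh′≡mc) ++ chain-translate h~⁺w (trans hh′≡mc mc≡we)

  connected-snc : StronglyNormalClosed S SiblingConnected
  connected-snc = ((zero , connected-zero) , connected-closed) , connected-normal
    where
    connected-zero : SiblingConnected zero
    connected-zero {b} {e} be≡0 = [ b , cong (rel b) (diag→ b e be≡0) ]
    connected-closed : _·_ S (_* S SiblingConnected) SiblingConnected ⊆ SiblingConnected
    connected-closed uv {b} {e} be≡k with ·-elim uv be≡k
    ... | m , bm∈ , me∈ = symmetric Sibling sibling-sym (bm∈ (tr-spec b m)) ++ me∈ refl
    connected-normal : ∀ i →
                       _·_ S (_·_ S (｛_｝ S (tr i)) SiblingConnected) (｛_｝ S i) ⊆ SiblingConnected
    connected-normal i conjugate ce≡k with ·-elim conjugate ce≡k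
    ... | w , cw∈ , we≡i with ·-elim cw∈ refl
    ...   | m , cm≡tri , mw∈ =
      chain-translate (mw∈ refl) (trans (rel-swap cm≡tri) (trans (tr-involutive i) (sym we≡i)))

  singular-elim : ∀ {P : Pred (Idx S) 0ℓ} → Singular S P →
                ∀ {a b c e f} → OLow S (rel a b) → rel c b ≡ rel c e → P (rel e f) → P (rel a f)
  singular-elim (_ , singular) {a} {b} {c} {e} {f} thin cb≡ce Pef =
    singular (rel a b) (rel c e) (rel e f) thin Pef
      (·-intro e (·-intro c (·-intro b refl (trans (tr-spec c b) (cong tr cb≡ce))) refl) refl)

  singular-intro : ∀ {P : Pred (Idx S) 0ℓ} → OLow S ⊆ P →
                   (∀ {a b c e f} → OLow S (rel a b) → rel c b ≡ rel c e →
                      P (rel e f) → P (rel a f)) →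
                   Singular S P
  singular-intro {P} OLow⊆P pointwise = OLow⊆P , λ x y z thin Pz → ·-⊆ (reroute thin Pz)
    where
    reroute : ∀ {x y z} → OLow S x → P z → ∀ {a e f} →
              _·_ S (_·_ S (｛_｝ S x) (｛_｝ S (tr y))) (｛_｝ S y) (rel a e) →
              rel e f ≡ z → P (rel a f)
    reroute {x} {y} {z} thin Pz ae∈ ef≡z with ·-elim ae∈ refl
    ... | c , ac∈ , ce≡y with ·-elim ac∈ refl
    ...   | b , ab≡x , bc≡try =
      pointwise (subst (OLow S) (sym ab≡x) thin)
        (trans (rel-swap bc≡try) (trans (tr-involutive y) (sym ce≡y))) (subst P (sym ef≡z) Pz)

  chain⇒singular : ∀ {P : Pred (Idx S) 0ℓ} → Singular S P →
                   ∀ {b e f} → SiblingChain b e → P (rel e f) → P (rel b f)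
  chain⇒singular singular [ _ , cb≡ce ]        = singular-elim singular (thin-refl _) cb≡ce
  chain⇒singular singular ((_ , cb≡ch) ∷ h~⁺e) =
    singular-elim singular (thin-refl _) cb≡ch ∘ chain⇒singular singular h~⁺e

  connected⊆singular : ∀ {P : Pred (Idx S) 0ℓ} → Singular S P → SiblingConnected ⊆ P
  connected⊆singular {P} singular {k} connected with nonempty k
  ... | b , e , refl =
    chain⇒singular singular (connected refl) (subst P (sym (→diag e)) (proj₁ singular thin-zero))

  OUp⊆singular : ∀ {P : Pred (Idx S) 0ℓ} → Decidable P → Singular S P → OUp S ⊆ P
  OUp⊆singular P? singular {i} i∈OUp =
    decidable-stable (P? i) (¬¬-map (connected⊆singular singular) (OUp⊆¬¬ connected-snc i∈OUp))

  OUp·OLow : Pred (Idx S) 0ℓ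
  OUp·OLow = _·_ S (OUp S) (OLow S)

  OUp·OLow-closed : Closed S (OUp·OLow)
  OUp·OLow-closed = closed-intro (zero , ⊆-·ˡ (closed-zero (proj₁ OUp-snc)) thin-zero) reroute
    where
    reroute : ∀ {a m b} → OUp·OLow (rel m a) → OUp·OLow (rel m b) → OUp·OLow (rel a b)
    reroute {a} {m} {b} ma∈ mb∈ with ·-elim ma∈ refl | ·-elim mb∈ refl
    ... | h₁ , mh₁∈ , h₁a-thin | h₂ , mh₂∈ , h₂b-thin with successor (rel h₁ a) h₂
    ...   | q , h₂q≡h₁a =
      ·-intro q (snc-conj OUp-snc (closed-elim (proj₁ OUp-snc) mh₁∈ mh₂∈) (sym h₂q≡h₁a))
                (thin-quotient (subst (OLow S) (sym h₂q≡h₁a) h₁a-thin) h₂b-thin)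

  OUp·OLow-singular : Singular S (OUp·OLow)
  OUp·OLow-singular = singular-intro (⊆-·ˡ (closed-zero (proj₁ OUp-snc))) reroute
    where
    reroute : ∀ {a b c e f} → OLow S (rel a b) → rel c b ≡ rel c e →
              OUp·OLow (rel e f) → OUp·OLow (rel a f)
    reroute {a} {b} {c} {e} thin cb≡ce ef∈ with ·-elim ef∈ refl
    ... | h , eh∈ , hf-thin with successor (rel b a) h
    ...   | h′ , hh′≡ba =
      ·-intro h′
        (snc-conj OUp-snc
          (closed-elim (proj₁ OUp-snc) (snc-sibling OUp-snc (sym cb≡ce)) eh∈) (sym hh′≡ba))
        (thin-quotient (subst (OLow S) (sym (trans hh′≡ba (tr-spec a b))) (thin-tr thin)) hf-thin)

  OUp·OLow⊆singular : ∀ {P : Pred (Idx S) 0ℓ} → Singular S P → OUp S ⊆ P → OUp·OLow ⊆ P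
  OUp·OLow⊆singular {P} singular OUp⊆P = ·-⊆ reroute
    where
    reroute : ∀ {a h f} → OUp S (rel a h) → OLow S (rel h f) → P (rel a f)
    reroute {a} {h} {f} ah∈ hf-thin with successor (rel h f) a
    ... | a′ , aa′≡hf =
      singular-elim singular {c = a′} (subst (OLow S) (sym aa′≡hf) hf-thin) refl
        (OUp⊆P (snc-conj OUp-snc ah∈ aa′≡hf))

lemma3p2 : ∀ {n d : ℕ} (S : Scheme n d) (T : Subset (suc d)) →
    Singular S (_∈ T) →
    (OUp S ⊆ (_∈ T))
    × Closed S (_·_ S (OUp S) (OLow S))
    × Singular S (_·_ S (OUp S) (OLow S))
    × (_·_ S (OUp S) (OLow S) ⊆ (_∈ T))
lemma3p2 S T singular =
  OUp⊆T , OUp·OLow-closed S , OUp·OLow-singular S , OUp·OLow⊆singular S singular OUp⊆T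
  where
  OUp⊆T : OUp S ⊆ (_∈ T)
  OUp⊆T = OUp⊆singular S (_∈? T) singular
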